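{- Let $P=([n],\preceq)$ be a poset, $0\le r\le m\le n$, let $U\subseteq[n]$ be an upset of $P$ with $l=|[n]\setminus U|\le r$, and suppose there is an $r$-error-correcting $P$-code $C\subseteq F^n$ with $|C|=2^{n-m}$. Then (a) $|\mathcal{B}_U^{r-l}|\le 2^{m-l}$; (b) if $|\mathcal{B}_U^{r-l}|=2^{m-l}$, then $C$ is $r$-perfect and $\widetilde P^r\subseteq U$.
   Context: $[n]=\{1,\dots,n\}$; subsets of $[n]$ are identified with their characteristic vectors in $F^n=\{0,1\}^n$, and $x+y$ is the symmetric difference. For a subset $Q\subseteq[n]$ with the order induced from $P$: an ideal of $Q$ is a set $I\subseteq Q$ such that $a\in I$, $b\in Q$, $b\preceq a$ imply $b\in I$; ${<}X{>}_Q$ is the smallest ideal of $Q$ containing $X\subseteq Q$; $\mathcal{B}_Q^s=\{x\subseteq Q: |{<}x{>}_Q|\le s\}$ (so $\mathcal{B}_P^s$ is the case $Q=[n]$). An upset of $P$ is a set $U$ such that $a\in U$, $b\succeq a$ imply $b\in U$. $\mathcal{I}_P^r$ is the set of ideals of $P$ of cardinality $r$; $P^r=\bigcup_{J\in\mathcal{I}_P^r}J$ and $\widetilde P^r=P^r\setminus\bigcap_{J\in\mathcal{I}_P^r}J$. A $P$-code $C\subseteq F^n$ is $r$-error-correcting (resp. $r$-perfect) if every $x\in F^n$ has at most one (resp. exactly one) representation $x=c+b$ with $c\in C$, $b\in\mathcal{B}_P^r$. -}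

module Defs where

open import Data.Nat using (ℕ; zero; suc; _+_; _≤ᵇ_)
open import Data.Bool using (Bool; true; false; _∧_; _∨_; _xor_; not; if_then_else_)
open import Data.Fin using (Fin)
open import Data.Vec using (Vec; []; _∷_; lookup; tabulate; zipWith)
open import Data.Fin.Subset using (Subset; _∈_; _⊆_; ∣_∣; ⊤; inside; outside)
open import Data.Fin.Subset.Properties using (_⊆?_)
open import Data.Product using (Σ; _×_; ∃; _,_)
open import Relation.Nullary using (¬_)
open import Relation.Nullary.Decidable using (⌊_⌋)
open import Relation.Binary.PropositionalEquality using (_≡_)

record FinPoset (n : ℕ) : Set where
  field
    _≼_     : Fin n → Fin n → Bool
    refl≼   : ∀ i → (i ≼ i) ≡ true
    antisym : ∀ i j → (i ≼ j) ≡ true → (j ≼ i) ≡ true → i ≡ j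
    trans≼  : ∀ i j k → (i ≼ j) ≡ true → (j ≼ k) ≡ true → (i ≼ k) ≡ true
open FinPoset public

-- F^n = {0,1}^n = subsets of [n]; addition is symmetric difference.
_⊕_ : ∀ {n} → Subset n → Subset n → Subset n
_⊕_ = zipWith _xor_

anyFin : ∀ {n} → (Fin n → Bool) → Bool
anyFin {zero}  f = false
anyFin {suc n} f = f Fin.zero ∨ anyFin (λ i → f (Fin.suc i))

countSubsets : ∀ {n} → (Subset n → Bool) → ℕ
countSubsets {zero}  p = if p [] then 1 else 0
countSubsets {suc n} p = countSubsets (λ v → p (outside ∷ v)) + countSubsets (λ v → p (inside ∷ v))

module _ {n : ℕ} (P : FinPoset n) where

  IsIdeal : Subset n → Subset n → Set
  IsIdeal Q I = I ⊆ Q × (∀ a b → a ∈ I → b ∈ Q → (P ._≼_ b a) ≡ true → b ∈ I)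

  -- <X>_Q : the smallest ideal of Q containing X (for X ⊆ Q),
  -- i.e. { b ∈ Q : b ≼ a for some a ∈ X }.
  gen : Subset n → Subset n → Subset n
  gen Q X = tabulate (λ b → lookup Q b ∧ anyFin (λ a → lookup X a ∧ P ._≼_ b a))

  -- membership in B_Q^s = { x ⊆ Q : |<x>_Q| ≤ s } (as a Boolean test)
  inBall : Subset n → ℕ → Subset n → Bool
  inBall Q s x = ⌊ x ⊆? Q ⌋ ∧ (∣ gen Q x ∣ ≤ᵇ s)

  ballSize : Subset n → ℕ → ℕ
  ballSize Q s = countSubsets (inBall Q s)

  IsUpset : Subset n → Set
  IsUpset U = ∀ a b → a ∈ U → (P ._≼_ a b) ≡ true → b ∈ U

  -- a ∈ P^r \ ⋂ I_P^r  (i.e. a ∈ P̃^r)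
  InPtilde : ℕ → Fin n → Set
  InPtilde r a =
    (∃ λ J → IsIdeal ⊤ J × ∣ J ∣ ≡ r × a ∈ J)
    × ¬ (∀ J → IsIdeal ⊤ J → ∣ J ∣ ≡ r → a ∈ J)

  -- Codes C ⊆ F^n are given by their Boolean membership test.
  ErrorCorrecting : ℕ → (Subset n → Bool) → Set
  ErrorCorrecting r C =
    ∀ x c b c′ b′ →
      C c ≡ true → inBall ⊤ r b ≡ true → x ≡ c ⊕ b →
      C c′ ≡ true → inBall ⊤ r b′ ≡ true → x ≡ c′ ⊕ b′ →
      c ≡ c′ × b ≡ b′

  Perfect : ℕ → (Subset n → Bool) → Set
  Perfect r C =
    ErrorCorrecting r C ×
    (∀ x → ∃ λ c → ∃ λ b → C c ≡ true × inBall ⊤ r b ≡ true × x ≡ c ⊕ b)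

-- Translates c + B_P^r of the code words are pairwise disjoint, so |C| |B_P^r| ≤ 2^n and
-- |B_P^r| ≤ 2^m.  On the other hand, if U is an upset then <z> ⊆ <z ∩ U>_U ∪ ([n] \ U), so
-- every z whose trace z ∩ U lies in B_U^{r-l} lies in B_P^r; there are 2^l |B_U^{r-l}|
-- such z, which gives (a).  In the case of equality both counts are tight: C is perfect,
-- and B_P^r consists exactly of the z with z ∩ U ∈ B_U^{r-l}.  An ideal J with |J| = r is
-- in B_P^r, so |J ∩ U| ≤ r - l, which forces J ⊇ [n] \ U; hence no point outside U lies
-- in P̃^r.
module Submission where

open import Defs
open import Data.Nat
  using (ℕ; zero; suc; _+_; _*_; _≤_; _<_; _∸_; _^_; _≤ᵇ_; NonZero; z≤n; s≤s; z<s)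
open import Data.Nat.Properties
open import Data.Bool using (Bool; true; false; _∧_)
open import Data.Bool.Properties using (T-≡)
open import Data.Fin using (Fin)
open import Data.Vec using ([]; _∷_; lookup; tail)
open import Data.Vec.Properties using (lookup∘tabulate; []=⇒lookup; lookup⇒[]=)
open import Data.Fin.Subset using (Subset; outside; inside; _∈_; _⊆_; _⊂_; _∩_; _∪_; ∁; ∣_∣; ⊤)
open import Data.Fin.Subset.Properties
  using (_⊆?_; _∈?_; ⊆⊤; p⊆q⇒∣p∣≤∣q∣; p⊂q⇒∣p∣<∣q∣; x∈p∩q⁺; x∈p∩q⁻; x∈p∪q⁺; p∩q⊆q; x∉p⇒x∈∁p)
open import Data.Product using (_×_; ∃; _,_; proj₁)
open import Data.Sum using (inj₁; inj₂)
open import Data.Empty using (⊥-elim)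
open import Function using (_∘_)
open import Function.Bundles using (Equivalence)
open import Relation.Nullary using (yes; no)
open import Relation.Nullary.Decidable using (⌊_⌋; ⌊⌋-map′; fromWitness)
open import Relation.Binary.PropositionalEquality
open import Algebra.Properties.CommutativeSemigroup +-commutativeSemigroup using (interchange)

∧-≡-true⁻ : ∀ {a b} → a ∧ b ≡ true → a ≡ true × b ≡ true
∧-≡-true⁻ {true} {true} _ = refl , refl

∧-≡-true⁺ : ∀ {a b} → a ≡ true → b ≡ true → a ∧ b ≡ true
∧-≡-true⁺ refl refl = refl

anyFin-≡-true⁻ : ∀ {n} (f : Fin n → Bool) → anyFin f ≡ true → ∃ λ i → f i ≡ true
anyFin-≡-true⁻ {suc n} f any with f Fin.zero in f0
... | true  = Fin.zero , f0
... | false = let i , fi = anyFin-≡-true⁻ (f ∘ Fin.suc) any in Fin.suc i , fi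

anyFin-≡-true⁺ : ∀ {n} (f : Fin n → Bool) i → f i ≡ true → anyFin f ≡ true
anyFin-≡-true⁺ f Fin.zero    fi rewrite fi = refl
anyFin-≡-true⁺ f (Fin.suc i) fi with f Fin.zero
... | true  = refl
... | false = anyFin-≡-true⁺ (f ∘ Fin.suc) i fi

≤ᵇ-≡-true⁺ : ∀ {m n} → m ≤ n → (m ≤ᵇ n) ≡ true
≤ᵇ-≡-true⁺ m≤n = Equivalence.to T-≡ (≤⇒≤ᵇ m≤n)

≤ᵇ-≡-true⁻ : ∀ {m n} → (m ≤ᵇ n) ≡ true → m ≤ n
≤ᵇ-≡-true⁻ {m} {n} m≤ᵇn = ≤ᵇ⇒≤ m n (Equivalence.from T-≡ m≤ᵇn)

^-∸-split : ∀ b {m n} → m ≤ n → b ^ n ≡ b ^ m * b ^ (n ∸ m)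
^-∸-split b {m} {n} m≤n = trans (cong (b ^_) (sym (m+[n∸m]≡n m≤n))) (^-distribˡ-+-* b m (n ∸ m))

sumSubsets : ∀ {n} → (Subset n → ℕ) → ℕ
sumSubsets {zero}  f = f []
sumSubsets {suc n} f = sumSubsets (f ∘ (outside ∷_)) + sumSubsets (f ∘ (inside ∷_))

sumSubsets-cong : ∀ {n} {f g : Subset n → ℕ} → (∀ x → f x ≡ g x) → sumSubsets f ≡ sumSubsets g
sumSubsets-cong {zero}  f≗g = f≗g []
sumSubsets-cong {suc n} f≗g =
  cong₂ _+_ (sumSubsets-cong (f≗g ∘ (outside ∷_))) (sumSubsets-cong (f≗g ∘ (inside ∷_)))

sumSubsets-mono : ∀ {n} {f g : Subset n → ℕ} → (∀ x → f x ≤ g x) → sumSubsets f ≤ sumSubsets g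
sumSubsets-mono {zero}  f≤g = f≤g []
sumSubsets-mono {suc n} f≤g =
  +-mono-≤ (sumSubsets-mono (f≤g ∘ (outside ∷_))) (sumSubsets-mono (f≤g ∘ (inside ∷_)))

sumSubsets-mono-tight : ∀ {n} {f g : Subset n → ℕ} → (∀ x → f x ≤ g x) →
  sumSubsets g ≤ sumSubsets f → ∀ x → f x ≡ g x
sumSubsets-mono-tight {zero}  f≤g Σg≤Σf [] = ≤-antisym (f≤g []) Σg≤Σf
sumSubsets-mono-tight {suc n} {f} {g} f≤g Σg≤Σf (b ∷ x) = half b x
  where
  out≤ : sumSubsets (f ∘ (outside ∷_)) ≤ sumSubsets (g ∘ (outside ∷_))
  out≤ = sumSubsets-mono (f≤g ∘ (outside ∷_))
  in≤ : sumSubsets (f ∘ (inside ∷_)) ≤ sumSubsets (g ∘ (inside ∷_))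
  in≤ = sumSubsets-mono (f≤g ∘ (inside ∷_))
  half : ∀ b → ∀ x → f (b ∷ x) ≡ g (b ∷ x)
  half false = sumSubsets-mono-tight (f≤g ∘ (outside ∷_))
    (+-cancelʳ-≤ _ _ _ (≤-trans (+-monoʳ-≤ _ in≤) Σg≤Σf))
  half true  = sumSubsets-mono-tight (f≤g ∘ (inside ∷_))
    (+-cancelˡ-≤ _ _ _ (≤-trans (+-monoˡ-≤ _ out≤) Σg≤Σf))

sumSubsets-+ : ∀ {n} (f g : Subset n → ℕ) →
  sumSubsets (λ x → f x + g x) ≡ sumSubsets f + sumSubsets g
sumSubsets-+ {zero}  f g = refl
sumSubsets-+ {suc n} f g =
  trans (cong₂ _+_ (sumSubsets-+ (f ∘ (outside ∷_)) (g ∘ (outside ∷_)))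
                   (sumSubsets-+ (f ∘ (inside ∷_)) (g ∘ (inside ∷_))))
        (interchange (sumSubsets (f ∘ (outside ∷_))) (sumSubsets (g ∘ (outside ∷_)))
                     (sumSubsets (f ∘ (inside ∷_))) (sumSubsets (g ∘ (inside ∷_))))

sumSubsets-*ˡ : ∀ {n} k (f : Subset n → ℕ) → sumSubsets (λ x → k * f x) ≡ k * sumSubsets f
sumSubsets-*ˡ {zero}  k f = refl
sumSubsets-*ˡ {suc n} k f =
  trans (cong₂ _+_ (sumSubsets-*ˡ k (f ∘ (outside ∷_))) (sumSubsets-*ˡ k (f ∘ (inside ∷_))))
        (sym (*-distribˡ-+ k _ _))

sumSubsets-1 : ∀ n → sumSubsets {n} (λ _ → 1) ≡ 2 ^ n
sumSubsets-1 zero    = refl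
sumSubsets-1 (suc n) rewrite sumSubsets-1 n = cong (2 ^ n +_) (sym (+-identityʳ (2 ^ n)))

sumSubsets-swap : ∀ {n k} (f : Subset n → Subset k → ℕ) →
  sumSubsets (λ x → sumSubsets (f x)) ≡ sumSubsets (λ y → sumSubsets (λ x → f x y))
sumSubsets-swap {zero}  f = refl
sumSubsets-swap {suc n} f =
  trans (cong₂ _+_ (sumSubsets-swap (f ∘ (outside ∷_))) (sumSubsets-swap (f ∘ (inside ∷_))))
        (sym (sumSubsets-+ (λ y → sumSubsets (λ x → f (outside ∷ x) y))
                           (λ y → sumSubsets (λ x → f (inside ∷ x) y))))

sumSubsets-⊕ : ∀ {n} (f : Subset n → ℕ) (c : Subset n) →
  sumSubsets (λ x → f (x ⊕ c)) ≡ sumSubsets f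
sumSubsets-⊕ {zero}  f []          = refl
sumSubsets-⊕ {suc n} f (false ∷ c) =
  cong₂ _+_ (sumSubsets-⊕ (f ∘ (outside ∷_)) c) (sumSubsets-⊕ (f ∘ (inside ∷_)) c)
sumSubsets-⊕ {suc n} f (true ∷ c)  =
  trans (cong₂ _+_ (sumSubsets-⊕ (f ∘ (inside ∷_)) c) (sumSubsets-⊕ (f ∘ (outside ∷_)) c))
        (+-comm (sumSubsets (f ∘ (inside ∷_))) (sumSubsets (f ∘ (outside ∷_))))

indicator : Bool → ℕ
indicator true  = 1
indicator false = 0

indicator-∧ : ∀ a b → indicator (a ∧ b) ≡ indicator a * indicator b
indicator-∧ true  b = sym (+-identityʳ (indicator b))
indicator-∧ false b = refl

indicator-mono : ∀ {a b} → (a ≡ true → b ≡ true) → indicator a ≤ indicator b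
indicator-mono {false} a⇒b = z≤n
indicator-mono {true}  a⇒b rewrite a⇒b refl = ≤-refl

indicator-injective : ∀ {a b} → indicator a ≡ indicator b → a ≡ b
indicator-injective {true}  {true}  _ = refl
indicator-injective {false} {false} _ = refl

countSubsets≡sumSubsets : ∀ {n} (p : Subset n → Bool) → countSubsets p ≡ sumSubsets (indicator ∘ p)
countSubsets≡sumSubsets {zero}  p with p []
... | true  = refl
... | false = refl
countSubsets≡sumSubsets {suc n} p =
  cong₂ _+_ (countSubsets≡sumSubsets (p ∘ (outside ∷_))) (countSubsets≡sumSubsets (p ∘ (inside ∷_)))

countSubsets-cong : ∀ {n} {p q : Subset n → Bool} → (∀ x → p x ≡ q x) →
  countSubsets p ≡ countSubsets q
countSubsets-cong {zero}  p≗q rewrite p≗q [] = refl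
countSubsets-cong {suc n} p≗q =
  cong₂ _+_ (countSubsets-cong (p≗q ∘ (outside ∷_))) (countSubsets-cong (p≗q ∘ (inside ∷_)))

countSubsets-false : ∀ n → countSubsets {n} (λ _ → false) ≡ 0
countSubsets-false zero    = refl
countSubsets-false (suc n) rewrite countSubsets-false n = refl

countSubsets-mono : ∀ {n} {p q : Subset n → Bool} → (∀ x → p x ≡ true → q x ≡ true) →
  countSubsets p ≤ countSubsets q
countSubsets-mono {p = p} {q} p⇒q =
  subst₂ _≤_ (sym (countSubsets≡sumSubsets p)) (sym (countSubsets≡sumSubsets q))
    (sumSubsets-mono (indicator-mono ∘ p⇒q))

countSubsets-mono-tight : ∀ {n} {p q : Subset n → Bool} → (∀ x → p x ≡ true → q x ≡ true) →
  countSubsets q ≤ countSubsets p → ∀ x → q x ≡ true → p x ≡ true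
countSubsets-mono-tight {p = p} {q} p⇒q #q≤#p x qx = trans p≡q qx
  where
  p≡q : p x ≡ q x
  p≡q = indicator-injective (sumSubsets-mono-tight (indicator-mono ∘ p⇒q)
    (subst₂ _≤_ (countSubsets≡sumSubsets q) (countSubsets≡sumSubsets p) #q≤#p) x)

countSubsets-witness : ∀ {n} (p : Subset n → Bool) → 0 < countSubsets p → ∃ λ x → p x ≡ true
countSubsets-witness {zero}  p 0<#p with p [] in p[]
... | true = [] , p[]
countSubsets-witness {suc n} p 0<#p with countSubsets (p ∘ (outside ∷_)) in #out
... | suc _ = let x , px = countSubsets-witness (p ∘ (outside ∷_)) (subst (0 <_) (sym #out) z<s)
              in outside ∷ x , px
... | zero  = let x , px = countSubsets-witness (p ∘ (inside ∷_)) 0<#p in inside ∷ x , px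

countSubsets-unique : ∀ {n} (p : Subset n → Bool) → (∀ x y → p x ≡ true → p y ≡ true → x ≡ y) →
  countSubsets p ≤ 1
countSubsets-unique {zero}  p _ with p []
... | true  = ≤-refl
... | false = z≤n
countSubsets-unique {suc n} p uniq
  with countSubsets (p ∘ (outside ∷_)) in #out | countSubsets (p ∘ (inside ∷_)) in #in
... | zero  | _     = subst (_≤ 1) #in
  (countSubsets-unique (p ∘ (inside ∷_)) (λ _ _ px py → cong tail (uniq _ _ px py)))
... | suc _ | zero  = subst (λ c → c + 0 ≤ 1) #out (≤-trans (≤-reflexive (+-identityʳ _))
  (countSubsets-unique (p ∘ (outside ∷_)) (λ _ _ px py → cong tail (uniq _ _ px py))))
... | suc _ | suc _ with countSubsets-witness (p ∘ (outside ∷_)) (subst (0 <_) (sym #out) z<s)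
                       | countSubsets-witness (p ∘ (inside ∷_)) (subst (0 <_) (sym #in) z<s)
...   | x , px | y , py with uniq _ _ px py
...     | ()

-- z ↦ z ∩ U maps 2 ^ ∣ ∁ U ∣ subsets onto each subset of U.
countSubsets-∩ : ∀ {n} (U : Subset n) (q : Subset n → Bool) →
  countSubsets (λ z → q (z ∩ U)) ≡ 2 ^ ∣ ∁ U ∣ * countSubsets (λ x → ⌊ x ⊆? U ⌋ ∧ q x)
countSubsets-∩ [] q with q []
... | true  = refl
... | false = refl
countSubsets-∩ (inside ∷ U) q = begin
  countSubsets (λ z → q (outside ∷ z ∩ U)) + countSubsets (λ z → q (inside ∷ z ∩ U))
    ≡⟨ cong₂ _+_ (countSubsets-∩ U (q ∘ (outside ∷_))) (countSubsets-∩ U (q ∘ (inside ∷_))) ⟩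
  2 ^ ∣ ∁ U ∣ * countSubsets (λ x → ⌊ x ⊆? U ⌋ ∧ q (outside ∷ x))
    + 2 ^ ∣ ∁ U ∣ * countSubsets (λ x → ⌊ x ⊆? U ⌋ ∧ q (inside ∷ x))
    ≡⟨ sym (*-distribˡ-+ (2 ^ ∣ ∁ U ∣) _ _) ⟩
  2 ^ ∣ ∁ U ∣ * (countSubsets (λ x → ⌊ x ⊆? U ⌋ ∧ q (outside ∷ x))
                 + countSubsets (λ x → ⌊ x ⊆? U ⌋ ∧ q (inside ∷ x)))
    ≡⟨ cong (2 ^ ∣ ∁ U ∣ *_) (cong₂ _+_
         (countSubsets-cong (λ x → cong (_∧ q (outside ∷ x)) (sym (⌊⌋-map′ _ _ (x ⊆? U)))))
         (countSubsets-cong (λ x → cong (_∧ q (inside ∷ x)) (sym (⌊⌋-map′ _ _ (x ⊆? U)))))) ⟩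
  2 ^ ∣ ∁ (inside ∷ U) ∣ * countSubsets (λ x → ⌊ x ⊆? inside ∷ U ⌋ ∧ q x) ∎
  where open ≡-Reasoning
countSubsets-∩ {suc n} (outside ∷ U) q = begin
  half + half
    ≡⟨ cong (half +_) (sym (+-identityʳ half)) ⟩
  2 * half
    ≡⟨ cong (2 *_) (countSubsets-∩ U (q ∘ (outside ∷_))) ⟩
  2 * (2 ^ ∣ ∁ U ∣ * countSubsets (λ x → ⌊ x ⊆? U ⌋ ∧ q (outside ∷ x)))
    ≡⟨ sym (*-assoc 2 (2 ^ ∣ ∁ U ∣) _) ⟩
  2 ^ ∣ ∁ (outside ∷ U) ∣ * countSubsets (λ x → ⌊ x ⊆? U ⌋ ∧ q (outside ∷ x))
    ≡⟨ cong (2 ^ ∣ ∁ (outside ∷ U) ∣ *_) (countSubsets-cong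
         (λ x → cong (_∧ q (outside ∷ x)) (sym (⌊⌋-map′ _ _ (x ⊆? U))))) ⟩
  2 ^ ∣ ∁ (outside ∷ U) ∣ * outsideHalf
    ≡⟨ cong (2 ^ ∣ ∁ (outside ∷ U) ∣ *_) (sym (+-identityʳ outsideHalf)) ⟩
  2 ^ ∣ ∁ (outside ∷ U) ∣ * (outsideHalf + 0)
    ≡⟨ cong (λ k → 2 ^ ∣ ∁ (outside ∷ U) ∣ * (outsideHalf + k)) (sym (countSubsets-false n)) ⟩
  2 ^ ∣ ∁ (outside ∷ U) ∣ * countSubsets (λ x → ⌊ x ⊆? outside ∷ U ⌋ ∧ q x) ∎
  where
  open ≡-Reasoning
  half = countSubsets (λ z → q (outside ∷ z ∩ U))
  outsideHalf = countSubsets (λ x → ⌊ outside ∷ x ⊆? outside ∷ U ⌋ ∧ q (outside ∷ x))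

⊕-cancelˡ : ∀ {n} (c x : Subset n) → c ⊕ (x ⊕ c) ≡ x
⊕-cancelˡ []          []          = refl
⊕-cancelˡ (true  ∷ c) (true  ∷ x) = cong (true ∷_) (⊕-cancelˡ c x)
⊕-cancelˡ (true  ∷ c) (false ∷ x) = cong (false ∷_) (⊕-cancelˡ c x)
⊕-cancelˡ (false ∷ c) (true  ∷ x) = cong (true ∷_) (⊕-cancelˡ c x)
⊕-cancelˡ (false ∷ c) (false ∷ x) = cong (false ∷_) (⊕-cancelˡ c x)

decompositions : ∀ {n} (C B : Subset n → Bool) → Subset n → ℕ
decompositions C B x = countSubsets (λ c → C c ∧ B (x ⊕ c))

sumSubsets-decompositions : ∀ {n} (C B : Subset n → Bool) →
  sumSubsets (decompositions C B) ≡ countSubsets C * countSubsets B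
sumSubsets-decompositions C B = begin
  sumSubsets (λ x → countSubsets (λ c → C c ∧ B (x ⊕ c)))
    ≡⟨ sumSubsets-cong (λ x → countSubsets≡sumSubsets (λ c → C c ∧ B (x ⊕ c))) ⟩
  sumSubsets (λ x → sumSubsets (λ c → indicator (C c ∧ B (x ⊕ c))))
    ≡⟨ sumSubsets-swap (λ x c → indicator (C c ∧ B (x ⊕ c))) ⟩
  sumSubsets (λ c → sumSubsets (λ x → indicator (C c ∧ B (x ⊕ c))))
    ≡⟨ sumSubsets-cong (λ c → sumSubsets-cong (λ x → indicator-∧ (C c) (B (x ⊕ c)))) ⟩
  sumSubsets (λ c → sumSubsets (λ x → indicator (C c) * indicator (B (x ⊕ c))))
    ≡⟨ sumSubsets-cong (λ c → sumSubsets-*ˡ (indicator (C c)) (λ x → indicator (B (x ⊕ c)))) ⟩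
  sumSubsets (λ c → indicator (C c) * sumSubsets (λ x → indicator (B (x ⊕ c))))
    ≡⟨ sumSubsets-cong (λ c → cong (indicator (C c) *_) (sumSubsets-⊕ (indicator ∘ B) c)) ⟩
  sumSubsets (λ c → indicator (C c) * #B)
    ≡⟨ sumSubsets-cong (λ c → *-comm (indicator (C c)) #B) ⟩
  sumSubsets (λ c → #B * indicator (C c))
    ≡⟨ sumSubsets-*ˡ #B (indicator ∘ C) ⟩
  #B * sumSubsets (indicator ∘ C)
    ≡⟨ *-comm #B _ ⟩
  sumSubsets (indicator ∘ C) * #B
    ≡⟨ cong₂ _*_ (sym (countSubsets≡sumSubsets C)) (sym (countSubsets≡sumSubsets B)) ⟩
  countSubsets C * countSubsets B ∎
  where
  open ≡-Reasoning
  #B = sumSubsets (indicator ∘ B)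

∣p∪q∣≤∣p∣+∣q∣ : ∀ {n} (p q : Subset n) → ∣ p ∪ q ∣ ≤ ∣ p ∣ + ∣ q ∣
∣p∪q∣≤∣p∣+∣q∣ []            []            = z≤n
∣p∪q∣≤∣p∣+∣q∣ (outside ∷ p) (outside ∷ q) = ∣p∪q∣≤∣p∣+∣q∣ p q
∣p∪q∣≤∣p∣+∣q∣ (inside  ∷ p) (outside ∷ q) = s≤s (∣p∪q∣≤∣p∣+∣q∣ p q)
∣p∪q∣≤∣p∣+∣q∣ (outside ∷ p) (inside  ∷ q) =
  ≤-trans (s≤s (∣p∪q∣≤∣p∣+∣q∣ p q)) (≤-reflexive (sym (+-suc ∣ p ∣ ∣ q ∣)))
∣p∪q∣≤∣p∣+∣q∣ (inside  ∷ p) (inside  ∷ q) =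
  s≤s (≤-trans (∣p∪q∣≤∣p∣+∣q∣ p q) (+-monoʳ-≤ ∣ p ∣ (n≤1+n ∣ q ∣)))

∣p∣≤∣p∩q∣+∣p∩∁q∣ : ∀ {n} (p q : Subset n) → ∣ p ∣ ≤ ∣ p ∩ q ∣ + ∣ p ∩ ∁ q ∣
∣p∣≤∣p∩q∣+∣p∩∁q∣ p q = ≤-trans (p⊆q⇒∣p∣≤∣q∣ p⊆split) (∣p∪q∣≤∣p∣+∣q∣ (p ∩ q) (p ∩ ∁ q))
  where
  p⊆split : p ⊆ (p ∩ q) ∪ (p ∩ ∁ q)
  p⊆split {x} x∈p with x ∈? q
  ... | yes x∈q = x∈p∪q⁺ (inj₁ (x∈p∩q⁺ (x∈p , x∈q)))
  ... | no  x∉q = x∈p∪q⁺ (inj₂ (x∈p∩q⁺ (x∈p , x∉p⇒x∈∁p x∉q)))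

∣p∩q∣+∣∁q∣≤∣p∣⇒∁q⊆p : ∀ {n} (p q : Subset n) → ∣ p ∩ q ∣ + ∣ ∁ q ∣ ≤ ∣ p ∣ → ∁ q ⊆ p
∣p∩q∣+∣∁q∣≤∣p∣⇒∁q⊆p p q bound {x} x∈∁q with x ∈? p
... | yes x∈p = x∈p
... | no  x∉p = ⊥-elim (<-irrefl refl (begin-strict
  ∣ p ∣                       ≤⟨ ∣p∣≤∣p∩q∣+∣p∩∁q∣ p q ⟩
  ∣ p ∩ q ∣ + ∣ p ∩ ∁ q ∣     <⟨ +-monoʳ-< ∣ p ∩ q ∣ (p⊂q⇒∣p∣<∣q∣ p∩∁q⊂∁q) ⟩
  ∣ p ∩ q ∣ + ∣ ∁ q ∣         ≤⟨ bound ⟩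
  ∣ p ∣                       ∎))
  where
  open ≤-Reasoning
  p∩∁q⊂∁q : p ∩ ∁ q ⊂ ∁ q
  p∩∁q⊂∁q = p∩q⊆q p (∁ q) , x , x∈∁q , x∉p ∘ proj₁ ∘ x∈p∩q⁻ p (∁ q)

module _ {n : ℕ} (P : FinPoset n) where
  open FinPoset P using () renaming (_≼_ to _⊑_; refl≼ to ⊑-refl)

  ∈-gen⁻ : ∀ {Q X i} → i ∈ gen P Q X → i ∈ Q × ∃ λ a → a ∈ X × (i ⊑ a) ≡ true
  ∈-gen⁻ {Q} {X} {i} i∈gen
    with ∧-≡-true⁻ (trans (sym (lookup∘tabulate _ i)) ([]=⇒lookup i∈gen))
  ... | i∈Q , below with anyFin-≡-true⁻ _ below
  ...   | a , a∈X∧i⊑a with ∧-≡-true⁻ a∈X∧i⊑a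
  ...     | a∈X , i⊑a = lookup⇒[]= i Q i∈Q , a , lookup⇒[]= a X a∈X , i⊑a

  ∈-gen⁺ : ∀ {Q X i a} → i ∈ Q → a ∈ X → (i ⊑ a) ≡ true → i ∈ gen P Q X
  ∈-gen⁺ {Q} {X} {i} {a} i∈Q a∈X i⊑a = lookup⇒[]= i (gen P Q X) (trans (lookup∘tabulate _ i)
    (∧-≡-true⁺ ([]=⇒lookup i∈Q)
      (anyFin-≡-true⁺ (λ b → lookup X b ∧ (i ⊑ b)) a (∧-≡-true⁺ ([]=⇒lookup a∈X) i⊑a))))

  ⊆-gen : ∀ {Q X} → X ⊆ Q → X ⊆ gen P Q X
  ⊆-gen X⊆Q {i} i∈X = ∈-gen⁺ (X⊆Q i∈X) i∈X (⊑-refl i)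

  ideal⇒gen⊆ : ∀ {J} → IsIdeal P ⊤ J → gen P ⊤ J ⊆ J
  ideal⇒gen⊆ {J} (_ , downward) i∈gen with ∈-gen⁻ {⊤} {J} i∈gen
  ... | i∈⊤ , a , a∈J , i⊑a = downward a _ a∈J i∈⊤ i⊑a

  -- If i ≼ a with a ∈ z and i ∈ U, then a ∈ U because U is an upset.
  upset⇒gen⊆ : ∀ {U} → IsUpset P U → ∀ z → gen P ⊤ z ⊆ gen P U (z ∩ U) ∪ ∁ U
  upset⇒gen⊆ {U} upward z {i} i∈gen with ∈-gen⁻ {⊤} {z} i∈gen | i ∈? U
  ... | _ , a , a∈z , i⊑a | yes i∈U =
    x∈p∪q⁺ (inj₁ (∈-gen⁺ {U} {z ∩ U} i∈U (x∈p∩q⁺ (a∈z , upward i a i∈U i⊑a)) i⊑a))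
  ... | _ | no i∉U = x∈p∪q⁺ (inj₂ (x∉p⇒x∈∁p i∉U))

  inBall-⊤⁺ : ∀ {s x} → ∣ gen P ⊤ x ∣ ≤ s → inBall P ⊤ s x ≡ true
  inBall-⊤⁺ {x = x} bound =
    ∧-≡-true⁺ (Equivalence.to T-≡ (fromWitness {a? = x ⊆? ⊤} ⊆⊤)) (≤ᵇ-≡-true⁺ bound)

  ideal∈ball : ∀ {J} → IsIdeal P ⊤ J → inBall P ⊤ ∣ J ∣ J ≡ true
  ideal∈ball isIdeal = inBall-⊤⁺ (p⊆q⇒∣p∣≤∣q∣ (ideal⇒gen⊆ isIdeal))

  trace∈ball⇒∈ball : ∀ {U} → IsUpset P U → ∀ {r} → ∣ ∁ U ∣ ≤ r → ∀ z →
    ∣ gen P U (z ∩ U) ∣ ≤ r ∸ ∣ ∁ U ∣ → ∣ gen P ⊤ z ∣ ≤ r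
  trace∈ball⇒∈ball {U} upward {r} l≤r z bound = begin
    ∣ gen P ⊤ z ∣                   ≤⟨ p⊆q⇒∣p∣≤∣q∣ (upset⇒gen⊆ upward z) ⟩
    ∣ gen P U (z ∩ U) ∪ ∁ U ∣       ≤⟨ ∣p∪q∣≤∣p∣+∣q∣ (gen P U (z ∩ U)) (∁ U) ⟩
    ∣ gen P U (z ∩ U) ∣ + ∣ ∁ U ∣   ≤⟨ +-monoˡ-≤ ∣ ∁ U ∣ bound ⟩
    r ∸ ∣ ∁ U ∣ + ∣ ∁ U ∣           ≡⟨ m∸n+n≡m l≤r ⟩
    r                               ∎
    where open ≤-Reasoning

  module _ {U} (upward : IsUpset P U) {r} (l≤r : ∣ ∁ U ∣ ≤ r) where
    private
      inRestrictedBall : Subset n → Bool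
      inRestrictedBall x = ∣ gen P U x ∣ ≤ᵇ r ∸ ∣ ∁ U ∣

      trace⇒ball : ∀ z → inRestrictedBall (z ∩ U) ≡ true → inBall P ⊤ r z ≡ true
      trace⇒ball z z∩U∈ball = inBall-⊤⁺ (trace∈ball⇒∈ball upward l≤r z (≤ᵇ-≡-true⁻ z∩U∈ball))

    restrictedBall≤ball : 2 ^ ∣ ∁ U ∣ * ballSize P U (r ∸ ∣ ∁ U ∣) ≤ ballSize P ⊤ r
    restrictedBall≤ball = begin
      2 ^ ∣ ∁ U ∣ * ballSize P U (r ∸ ∣ ∁ U ∣)  ≡⟨ countSubsets-∩ U inRestrictedBall ⟨
      countSubsets (inRestrictedBall ∘ (_∩ U))  ≤⟨ countSubsets-mono trace⇒ball ⟩
      ballSize P ⊤ r                            ∎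
      where open ≤-Reasoning

    ball⊆restrictedBall : ballSize P ⊤ r ≤ 2 ^ ∣ ∁ U ∣ * ballSize P U (r ∸ ∣ ∁ U ∣) →
      ∀ z → inBall P ⊤ r z ≡ true → ∣ gen P U (z ∩ U) ∣ ≤ r ∸ ∣ ∁ U ∣
    ball⊆restrictedBall tight z z∈ball = ≤ᵇ-≡-true⁻ (countSubsets-mono-tight trace⇒ball
      (subst (ballSize P ⊤ r ≤_) (sym (countSubsets-∩ U inRestrictedBall)) tight) z z∈ball)

  ptilde⊆upset : ∀ {U r} → ∣ ∁ U ∣ ≤ r →
    (∀ z → inBall P ⊤ r z ≡ true → ∣ gen P U (z ∩ U) ∣ ≤ r ∸ ∣ ∁ U ∣) →
    ∀ a → InPtilde P r a → a ∈ U
  ptilde⊆upset {U} {r} l≤r ball⊆ a (_ , notInAllIdeals) with a ∈? U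
  ... | yes a∈U = a∈U
  ... | no  a∉U = ⊥-elim (notInAllIdeals λ J isIdeal ∣J∣≡r → ∁U⊆J J isIdeal ∣J∣≡r (x∉p⇒x∈∁p a∉U))
    where
    ∁U⊆J : ∀ J → IsIdeal P ⊤ J → ∣ J ∣ ≡ r → ∁ U ⊆ J
    ∁U⊆J J isIdeal ∣J∣≡r = ∣p∩q∣+∣∁q∣≤∣p∣⇒∁q⊆p J U (begin
      ∣ J ∩ U ∣ + ∣ ∁ U ∣              ≤⟨ +-monoˡ-≤ ∣ ∁ U ∣ ∣J∩U∣≤r-l ⟩
      r ∸ ∣ ∁ U ∣ + ∣ ∁ U ∣            ≡⟨ m∸n+n≡m l≤r ⟩
      r                                ≡⟨ ∣J∣≡r ⟨
      ∣ J ∣                            ∎)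
      where
      open ≤-Reasoning
      J∈ball : inBall P ⊤ r J ≡ true
      J∈ball = subst (λ s → inBall P ⊤ s J ≡ true) ∣J∣≡r (ideal∈ball isIdeal)
      ∣J∩U∣≤r-l : ∣ J ∩ U ∣ ≤ r ∸ ∣ ∁ U ∣
      ∣J∩U∣≤r-l = ≤-trans (p⊆q⇒∣p∣≤∣q∣ (⊆-gen (p∩q⊆q J U))) (ball⊆ J J∈ball)

  module _ {r} {C : Subset n → Bool} (correcting : ErrorCorrecting P r C) where

    decompositions≤1 : ∀ x → decompositions C (inBall P ⊤ r) x ≤ 1
    decompositions≤1 x = countSubsets-unique _ λ c c′ c∈ c′∈ →
      let c∈C , x⊕c∈ball = ∧-≡-true⁻ c∈ ; c′∈C , x⊕c′∈ball = ∧-≡-true⁻ c′∈ in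
      proj₁ (correcting x c (x ⊕ c) c′ (x ⊕ c′)
        c∈C x⊕c∈ball (sym (⊕-cancelˡ c x)) c′∈C x⊕c′∈ball (sym (⊕-cancelˡ c′ x)))

    sphere-packing-bound : countSubsets C * ballSize P ⊤ r ≤ 2 ^ n
    sphere-packing-bound = begin
      countSubsets C * ballSize P ⊤ r               ≡⟨ sumSubsets-decompositions C (inBall P ⊤ r) ⟨
      sumSubsets (decompositions C (inBall P ⊤ r))  ≤⟨ sumSubsets-mono decompositions≤1 ⟩
      sumSubsets {n} (λ _ → 1)                      ≡⟨ sumSubsets-1 n ⟩
      2 ^ n                                         ∎
      where open ≤-Reasoning

    sphere-packing-tight⇒perfect : 2 ^ n ≤ countSubsets C * ballSize P ⊤ r → Perfect P r C
    sphere-packing-tight⇒perfect tight = correcting , decompose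
      where
      unique : ∀ x → decompositions C (inBall P ⊤ r) x ≡ 1
      unique = sumSubsets-mono-tight decompositions≤1
        (subst₂ _≤_ (sym (sumSubsets-1 n)) (sym (sumSubsets-decompositions C (inBall P ⊤ r))) tight)
      decompose : ∀ x → ∃ λ c → ∃ λ b → C c ≡ true × inBall P ⊤ r b ≡ true × x ≡ c ⊕ b
      decompose x with countSubsets-witness _ (subst (0 <_) (sym (unique x)) z<s)
      ... | c , c∈ with ∧-≡-true⁻ c∈
      ...   | c∈C , x⊕c∈ball = c , x ⊕ c , c∈C , x⊕c∈ball , sym (⊕-cancelˡ c x)

    module _ {m} (m≤n : m ≤ n) (∣C∣≡ : countSubsets C ≡ 2 ^ (n ∸ m)) where
      private
        2^n≡∣C∣*2^m : 2 ^ n ≡ countSubsets C * 2 ^ m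
        2^n≡∣C∣*2^m =
          trans (^-∸-split 2 m≤n) (trans (*-comm (2 ^ m) _) (cong (_* 2 ^ m) (sym ∣C∣≡)))

      ballSize≤2^m : ballSize P ⊤ r ≤ 2 ^ m
      ballSize≤2^m = *-cancelˡ-≤ (countSubsets C) {{subst NonZero (sym ∣C∣≡) (m^n≢0 2 (n ∸ m))}}
        (≤-trans sphere-packing-bound (≤-reflexive 2^n≡∣C∣*2^m))

      2^m≤ballSize⇒perfect : 2 ^ m ≤ ballSize P ⊤ r → Perfect P r C
      2^m≤ballSize⇒perfect 2^m≤ = sphere-packing-tight⇒perfect
        (≤-trans (≤-reflexive 2^n≡∣C∣*2^m) (*-monoʳ-≤ (countSubsets C) 2^m≤))

proposition9 : (n : ℕ) (P : FinPoset n) (r m : ℕ) → r ≤ m → m ≤ n →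
    (U : Subset n) → IsUpset P U → ∣ ∁ U ∣ ≤ r →
    (C : Subset n → Bool) → ErrorCorrecting P r C → countSubsets C ≡ 2 ^ (n ∸ m) →
    (ballSize P U (r ∸ ∣ ∁ U ∣) ≤ 2 ^ (m ∸ ∣ ∁ U ∣))
    × (ballSize P U (r ∸ ∣ ∁ U ∣) ≡ 2 ^ (m ∸ ∣ ∁ U ∣) →
       Perfect P r C × (∀ a → InPtilde P r a → a ∈ U))
proposition9 n P r m r≤m m≤n U upward l≤r C correcting ∣C∣≡ = restrictedBound , equalityCase
  where
  l = ∣ ∁ U ∣
  2^m≡ : 2 ^ m ≡ 2 ^ l * 2 ^ (m ∸ l)
  2^m≡ = ^-∸-split 2 (≤-trans l≤r r≤m)
  ball≤2^m : ballSize P ⊤ r ≤ 2 ^ l * 2 ^ (m ∸ l)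
  ball≤2^m = subst (ballSize P ⊤ r ≤_) 2^m≡ (ballSize≤2^m P correcting m≤n ∣C∣≡)
  restrictedBound : ballSize P U (r ∸ l) ≤ 2 ^ (m ∸ l)
  restrictedBound = *-cancelˡ-≤ (2 ^ l) {{m^n≢0 2 l}}
    (≤-trans (restrictedBall≤ball P upward l≤r) ball≤2^m)
  equalityCase : ballSize P U (r ∸ l) ≡ 2 ^ (m ∸ l) → Perfect P r C × (∀ a → InPtilde P r a → a ∈ U)
  equalityCase tight =
    perfect , ptilde⊆upset P l≤r (ball⊆restrictedBall P upward l≤r ball≤restricted)
    where
    ball≤restricted : ballSize P ⊤ r ≤ 2 ^ l * ballSize P U (r ∸ l)
    ball≤restricted = subst (λ b → ballSize P ⊤ r ≤ 2 ^ l * b) (sym tight) ball≤2^m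
    perfect : Perfect P r C
    perfect = 2^m≤ballSize⇒perfect P correcting m≤n ∣C∣≡ (subst (_≤ ballSize P ⊤ r) (sym 2^m≡)
      (subst (λ b → 2 ^ l * b ≤ ballSize P ⊤ r) tight (restrictedBall≤ball P upward l≤r)))
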